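{- The canonical model $\langle W, \mathcal{N}, \leq, V \rangle$ is a PN-model; in particular, for all $w, v \in W$ and $X \subseteq W$, if $w \leq v$, $v \in X$ and $X \in \mathcal{N}_w$, then $X \in \mathcal{N}_v$.
   Context: Formulas are built from a denumerable set $PV$ of propositional variables and $\bot$ using $\land, \lor, \rightarrow, \Box$. The logic $L$ is the smallest set of formulas containing all instances of the intuitionistic propositional axiom schemes (in this language) and of $\Box \varphi \rightarrow \varphi$, closed under modus ponens and the rule: from $\varphi \leftrightarrow \psi$ infer $\Box \varphi \leftrightarrow \Box \psi$. An $L$-theory is a set of formulas containing all theorems of $L$ and closed under modus ponens; it is prime if $\bot \notin w$ and $\varphi \lor \psi \in w$ iff $\varphi \in w$ or $\psi \in w$. The canonical model: $W$ is the set of all prime $L$-theories; $w \leq v$ iff $w \subseteq v$; $\mathcal{N}_w = \{\{z \in W : \varphi \in z\} : \Box \varphi \in w\}$; $V(q) = \{w \in W : q \in w\}$. A PN-model is $\langle W, \mathcal{N}, \leq, V \rangle$ with $\leq$ a partial order on $W$, $\mathcal{N}: W \to P(P(W))$ such that $w \leq v$, $v \in X \subseteq W$, $X \in \mathcal{N}_w$ imply $X \in \mathcal{N}_v$, and $V: PV \to P(W)$ such that $w \in V(q)$, $w \leq v$ imply $v \in V(q)$. -}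

module Defs where

open import Level using (Level; _⊔_; 0ℓ) renaming (suc to lsuc)
open import Data.Nat using (ℕ)
open import Data.Product using (Σ; ∃; ∃-syntax; _×_; _,_)
open import Data.Sum using (_⊎_)
open import Data.Empty using (⊥)
open import Relation.Nullary using (¬_)
open import Relation.Binary.Core using (Rel)
open import Relation.Binary.Structures using (IsPartialOrder)

infixr 6 _∧'_
infixr 5 _∨'_
infixr 4 _⇒_

data Formula : Set where
  var  : ℕ → Formula
  ⊥'   : Formula
  _∧'_ : Formula → Formula → Formula
  _∨'_ : Formula → Formula → Formula
  _⇒_  : Formula → Formula → Formula
  □    : Formula → Formula

_⇔'_ : Formula → Formula → Formula
φ ⇔' ψ = (φ ⇒ ψ) ∧' (ψ ⇒ φ)

data IntAxiom : Formula → Set where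
  ax-K    : ∀ φ ψ → IntAxiom (φ ⇒ ψ ⇒ φ)
  ax-S    : ∀ φ ψ χ → IntAxiom ((φ ⇒ ψ ⇒ χ) ⇒ (φ ⇒ ψ) ⇒ φ ⇒ χ)
  ax-∧E₁  : ∀ φ ψ → IntAxiom (φ ∧' ψ ⇒ φ)
  ax-∧E₂  : ∀ φ ψ → IntAxiom (φ ∧' ψ ⇒ ψ)
  ax-∧I   : ∀ φ ψ → IntAxiom (φ ⇒ ψ ⇒ φ ∧' ψ)
  ax-∨I₁  : ∀ φ ψ → IntAxiom (φ ⇒ φ ∨' ψ)
  ax-∨I₂  : ∀ φ ψ → IntAxiom (ψ ⇒ φ ∨' ψ)
  ax-∨E   : ∀ φ ψ χ → IntAxiom ((φ ⇒ χ) ⇒ (ψ ⇒ χ) ⇒ φ ∨' ψ ⇒ χ)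
  ax-⊥E   : ∀ φ → IntAxiom (⊥' ⇒ φ)

data L : Formula → Set where
  int  : ∀ {φ} → IntAxiom φ → L φ
  ax-T : ∀ φ → L (□ φ ⇒ φ)
  mp   : ∀ {φ ψ} → L (φ ⇒ ψ) → L φ → L ψ
  re   : ∀ {φ ψ} → L (φ ⇔' ψ) → L (□ φ ⇔' □ ψ)

FSet : Set₁
FSet = Formula → Set

record IsLTheory (w : FSet) : Set where
  field
    thm : ∀ {φ} → L φ → w φ
    mpC : ∀ {φ ψ} → w (φ ⇒ ψ) → w φ → w ψ

record IsPrimeLTheory (w : FSet) : Set where
  field
    isLTheory : IsLTheory w
    consistent : ¬ w ⊥'
    prime-⇒ : ∀ {φ ψ} → w (φ ∨' ψ) → w φ ⊎ w ψ
    prime-⇐ : ∀ {φ ψ} → w φ ⊎ w ψ → w (φ ∨' ψ)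

-- PN-models (generic). Subsets of W are predicates W → Set s;
-- N w is a family of such subsets; V assigns upsets to variables.
-- The partial order is w.r.t. a given equality _≈_ on W.

record IsPNModel {a ℓ₁ ℓ₂ s n v : Level} (W : Set a)
                 (_≈_ : Rel W ℓ₁) (_≤_ : Rel W ℓ₂)
                 (N : W → (W → Set s) → Set n)
                 (V : ℕ → W → Set v)
                 : Set (a ⊔ ℓ₁ ⊔ ℓ₂ ⊔ lsuc s ⊔ n ⊔ v) where
  field
    isPartialOrder : IsPartialOrder _≈_ _≤_
    N-mono : ∀ {w u : W} {X : W → Set s} → w ≤ u → X u → N w X → N u X
    V-mono : ∀ (q : ℕ) {w u : W} → V q w → w ≤ u → V q u

Wc : Set₁
Wc = Σ FSet IsPrimeLTheory

_∈c_ : Formula → Wc → Set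
φ ∈c (w , _) = w φ

_≤c_ : Rel Wc 0ℓ
w ≤c v = ∀ φ → φ ∈c w → φ ∈c v

_≈c_ : Rel Wc 0ℓ
w ≈c v = (w ≤c v) × (v ≤c w)

⟦_⟧c : Formula → Wc → Set
⟦ φ ⟧c z = φ ∈c z

_≐_ : (Wc → Set) → (Wc → Set) → Set₁
X ≐ Y = ∀ z → (X z → Y z) × (Y z → X z)

Nc : Wc → (Wc → Set) → Set₁
Nc w X = ∃[ φ ] (□ φ ∈c w × X ≐ ⟦ φ ⟧c)

Vc : ℕ → Wc → Set
Vc q w = var q ∈c w

module Submission where

open import Defs
open import Data.Product using (_,_; proj₁)
open import Relation.Binary.Structures using (IsEquivalence; IsPreorder; IsPartialOrder)

≤c-refl : ∀ w → w ≤c w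
≤c-refl w φ φ∈w = φ∈w

≤c-trans : ∀ {w u v} → w ≤c u → u ≤c v → w ≤c v
≤c-trans w≤u u≤v φ φ∈w = u≤v φ (w≤u φ φ∈w)

≈c-isEquivalence : IsEquivalence _≈c_
≈c-isEquivalence = record
  { refl  = λ {w} → ≤c-refl w , ≤c-refl w
  ; sym   = λ { (w≤v , v≤w) → v≤w , w≤v }
  ; trans = λ { {w} {u} {v} (w≤u , u≤w) (u≤v , v≤u) → ≤c-trans {w} {u} {v} w≤u u≤v , ≤c-trans {v} {u} {w} v≤u u≤w }
  }

≤c-isPartialOrder : IsPartialOrder _≈c_ _≤c_
≤c-isPartialOrder = record
  { isPreorder = record
    { isEquivalence = ≈c-isEquivalence
    ; reflexive     = proj₁
    ; trans         = λ {w} {u} {v} → ≤c-trans {w} {u} {v}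
    }
  ; antisym = _,_
  }

Nc-mono : ∀ {w v} {X : Wc → Set} → w ≤c v → Nc w X → Nc v X
Nc-mono w≤v (φ , □φ∈w , X≐⟦φ⟧) = φ , w≤v (□ φ) □φ∈w , X≐⟦φ⟧

Vc-mono : ∀ q {w v} → Vc q w → w ≤c v → Vc q v
Vc-mono q q∈w w≤v = w≤v (var q) q∈w

mainTheorem6 : IsPNModel Wc _≈c_ _≤c_ Nc Vc
mainTheorem6 = record
  { isPartialOrder = ≤c-isPartialOrder
  ; N-mono         = λ {w} {v} w≤v _ → Nc-mono {w} {v} w≤v
  ; V-mono         = Vc-mono
  }
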